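{- Let $q>c>0$ and $n\ge1$ be integers, and let $x$ be an integer with $$0\le x\le\begin{cases} c(q/c)^n-c & \text{if } c \text{ divides } q,\\ (q/c)^{n-1}(q-c) & \text{otherwise.}\end{cases}$$ Define $v_0=0$ and $v_{i+1}=\left\lfloor\frac{(v_i+1)c+x}{q}\right\rfloor$ for $i\ge 0$. Then $$\left\lfloor\frac{x}{q-c}\right\rfloor=v_n.$$ -}

module Defs where

open import Data.Nat using (ℕ; zero; suc; _+_; _*_; _∸_; _^_; _≤_; NonZero)
open import Data.Nat.DivMod using (_/_)
open import Data.Nat.Divisibility using (_∣_)
open import Relation.Nullary using (¬_)
open import Data.Product using (_×_)

v : (q c x : ℕ) → .{{NonZero q}} → ℕ → ℕ
v q c x zero = 0
v q c x (suc i) = ((v q c x i + 1) * c + x) / q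

-- Otherwise: x ≤ (q/c)^(n-1) (q-c) as rationals, i.e. (multiplying by c^(n-1) > 0)
--   x * c^(n-1) ≤ q^(n-1) * (q - c).
Bound : (q c n x : ℕ) → .{{NonZero c}} → Set
Bound q c n x = (c ∣ q → x ≤ c * (q / c) ^ n ∸ c)
              × (¬ (c ∣ q) → x * c ^ (n ∸ 1) ≤ q ^ (n ∸ 1) * (q ∸ c))

-- Put e = q − c and k = ⌊x/e⌋. The recursion never overshoots k, and if d = k − s is the gap of
-- s below k, then the gap d' of the next term satisfies d'q < e + dc. Hence any gap of at most
-- K_j is closed after j steps, where K_0 = 0 and K_{j+1} = 1 + ⌊q K_j / c⌋. The bound on x is
-- what makes k ≤ K_n: always q^(n−1) ≤ K_n c^(n−1), and c((q/c)^n − 1) = K_n e when c divides q.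
module Submission where

open import Defs
open import Data.Nat using (ℕ; zero; suc; _+_; _*_; _^_; _<_; _≤_; _∸_; NonZero; >-nonZero; z≤n; s≤s)
open import Data.Nat.Properties
open import Data.Nat.DivMod using (_/_; _%_; m/n*n≤m; m%n<n; m≡m%n+[m/n]*n; m*n/n≡m; m<n*o⇒m/o<n)
open import Data.Nat.Divisibility using (_∣?_; divides)
open import Data.Nat.Tactic.RingSolver using (solve-∀)
open import Relation.Binary.PropositionalEquality
open import Data.Product using (_,_)
open import Relation.Nullary using (yes; no; contradiction)

m<[1+m/n]*n : ∀ m n .{{_ : NonZero n}} → m < suc (m / n) * n
m<[1+m/n]*n m n = begin-strict
  m                 ≡⟨ m≡m%n+[m/n]*n m n ⟩
  m % n + m / n * n <⟨ +-monoˡ-< (m / n * n) (m%n<n m n) ⟩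
  n + m / n * n     ∎
  where open ≤-Reasoning

m≤n*o⇒m/o≤n : ∀ {m n o} .{{_ : NonZero o}} → m ≤ n * o → m / o ≤ n
m≤n*o⇒m/o≤n {m} {n} {o} m≤n*o = *-cancelʳ-≤ (m / o) n o (≤-trans (m/n*n≤m m o) m≤n*o)

numerator-bound : ∀ {s k c e x} → s ≤ k → x < suc k * e → (s + 1) * c + x < suc k * (c + e)
numerator-bound {s} {k} {c} {e} {x} s≤k x<[1+k]e = begin-strict
  (s + 1) * c + x         <⟨ +-mono-≤-< (*-monoˡ-≤ c (+-monoˡ-≤ 1 s≤k)) x<[1+k]e ⟩
  (k + 1) * c + suc k * e ≡⟨ regroup k c e ⟩
  suc k * (c + e)         ∎
  where
  open ≤-Reasoning
  regroup : ∀ k c e → (k + 1) * c + suc k * e ≡ suc k * (c + e)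
  regroup = solve-∀

-- The gap estimate d'(c + e) < e + dc for t = ⌊((s+1)c + x)/(c + e)⌋, rearranged so that no
-- subtraction occurs.
gap-shrinks : ∀ {s d t d' c e x} → s + d ≡ t + d' → (t + d') * e ≤ x
            → (s + 1) * c + x < suc t * (c + e) → d' * (c + e) + c < (c + e) + d * c
gap-shrinks {s} {d} {t} {d'} {c} {e} {x} s+d≡t+d' [t+d']e≤x numerator< =
  +-cancelˡ-< (s * c + t * e) _ _ (begin-strict
    s * c + t * e + (d' * (c + e) + c)   ≡⟨ regroup₁ s t d' c e ⟩
    (s + 1) * c + (t + d') * e + d' * c  ≤⟨ +-monoˡ-≤ (d' * c) (+-monoʳ-≤ ((s + 1) * c) [t+d']e≤x) ⟩
    (s + 1) * c + x + d' * c             <⟨ +-monoˡ-< (d' * c) numerator< ⟩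
    suc t * (c + e) + d' * c             ≡⟨ regroup₂ t d' c e ⟩
    (t + d') * c + (c + e + t * e)       ≡⟨ cong (λ z → z * c + (c + e + t * e)) (sym s+d≡t+d') ⟩
    (s + d) * c + (c + e + t * e)        ≡⟨ regroup₃ s d c e t ⟩
    s * c + t * e + ((c + e) + d * c)    ∎)
  where
  open ≤-Reasoning
  regroup₁ : ∀ s t d' c e → s * c + t * e + (d' * (c + e) + c) ≡ (s + 1) * c + (t + d') * e + d' * c
  regroup₁ = solve-∀
  regroup₂ : ∀ t d' c e → suc t * (c + e) + d' * c ≡ (t + d') * c + (c + e + t * e)
  regroup₂ = solve-∀
  regroup₃ : ∀ s d c e t → (s + d) * c + (c + e + t * e) ≡ s * c + t * e + ((c + e) + d * c)
  regroup₃ = solve-∀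

gap-closes : ∀ {d d' c e K K'} → d' * (c + e) + c < (c + e) + d * c
           → d ≤ suc K' → K' * c ≤ (c + e) * K → d' ≤ K
gap-closes {d} {d'} {c} {e} {K} {K'} shrinks d≤1+K' K'c≤[c+e]K =
  m<1+n⇒m≤n (*-cancelʳ-< _ _ _ (+-cancelˡ-< c _ _ (begin-strict
    c + d' * (c + e)            ≡⟨ +-comm c _ ⟩
    d' * (c + e) + c            <⟨ shrinks ⟩
    (c + e) + d * c             ≤⟨ +-monoʳ-≤ (c + e) (*-monoˡ-≤ c d≤1+K') ⟩
    (c + e) + (c + K' * c)      ≤⟨ +-monoʳ-≤ (c + e) (+-monoʳ-≤ c K'c≤[c+e]K) ⟩
    (c + e) + (c + (c + e) * K) ≡⟨ regroup c e K ⟩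
    c + suc K * (c + e)         ∎)))
  where
  open ≤-Reasoning
  regroup : ∀ c e K → (c + e) + (c + (c + e) * K) ≡ c + suc K * (c + e)
  regroup = solve-∀

gapBound : (q c : ℕ) → .{{NonZero c}} → ℕ → ℕ
gapBound q c zero    = 0
gapBound q c (suc j) = suc (q * gapBound q c j / c)

^-≤-gapBound*^ : ∀ q c j .{{_ : NonZero c}} → q ^ j ≤ gapBound q c (suc j) * c ^ j
^-≤-gapBound*^ q c zero    = s≤s z≤n
^-≤-gapBound*^ q c (suc j) = begin
  q * q ^ j                          ≤⟨ *-monoʳ-≤ q (^-≤-gapBound*^ q c j) ⟩
  q * (K (suc j) * c ^ j)            ≡⟨ sym (*-assoc q _ _) ⟩
  q * K (suc j) * c ^ j              ≤⟨ *-monoˡ-≤ (c ^ j) qK≤cK' ⟩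
  (c * K (suc (suc j))) * c ^ j      ≡⟨ regroup c (K (suc (suc j))) (c ^ j) ⟩
  K (suc (suc j)) * (c * c ^ j)      ∎
  where
  open ≤-Reasoning
  K : ℕ → ℕ
  K = gapBound q c
  qK≤cK' : q * K (suc j) ≤ c * K (suc (suc j))
  qK≤cK' = subst (q * K (suc j) ≤_) (*-comm _ c) (<⇒≤ (m<[1+m/n]*n (q * K (suc j)) c))
  regroup : ∀ a b d → a * b * d ≡ b * (a * d)
  regroup = solve-∀

nondivisible-bound : ∀ {q c e x} m .{{_ : NonZero c}}
                   → x * c ^ m ≤ q ^ m * e → x ≤ gapBound q c (suc m) * e
nondivisible-bound {q} {c} {e} {x} m xc^m≤q^me =
  *-cancelʳ-≤ x _ (c ^ m) {{m^n≢0 c m}} (begin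
    x * c ^ m                           ≤⟨ xc^m≤q^me ⟩
    q ^ m * e                           ≤⟨ *-monoˡ-≤ e (^-≤-gapBound*^ q c m) ⟩
    gapBound q c (suc m) * c ^ m * e    ≡⟨ regroup (gapBound q c (suc m)) (c ^ m) e ⟩
    gapBound q c (suc m) * e * c ^ m    ∎)
  where
  open ≤-Reasoning
  regroup : ∀ a b d → a * b * d ≡ a * d * b
  regroup = solve-∀

gapBound-closed-form : ∀ {q c p} j .{{_ : NonZero c}} → q ≡ suc p * c
                     → gapBound q c j * p + 1 ≡ suc p ^ j
gapBound-closed-form zero    q≡[1+p]c = refl
gapBound-closed-form {q} {c} {p} (suc j) q≡[1+p]c = begin
  suc (q * K / c) * p + 1        ≡⟨ cong (λ z → suc z * p + 1) qK/c≡[1+p]K ⟩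
  suc (suc p * K) * p + 1        ≡⟨ regroup₁ p K ⟩
  suc p * (K * p + 1)            ≡⟨ cong (suc p *_) (gapBound-closed-form j q≡[1+p]c) ⟩
  suc p * suc p ^ j              ∎
  where
  open ≡-Reasoning
  K : ℕ
  K = gapBound q c j
  regroup₁ : ∀ p K → suc (suc p * K) * p + 1 ≡ suc p * (K * p + 1)
  regroup₁ = solve-∀
  regroup₂ : ∀ a b d → a * b * d ≡ a * d * b
  regroup₂ = solve-∀
  qK/c≡[1+p]K : q * K / c ≡ suc p * K
  qK/c≡[1+p]K = trans (cong (_/ c) (trans (cong (_* K) q≡[1+p]c) (regroup₂ (suc p) c K)))
                      (m*n/n≡m (suc p * K) c)

divisible-bound : ∀ {q c p} n .{{_ : NonZero c}} → q ≡ suc p * c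
                → c * (q / c) ^ n ∸ c ≡ gapBound q c n * (q ∸ c)
divisible-bound {q} {c} {p} n q≡[1+p]c = begin
  c * (q / c) ^ n ∸ c          ≡⟨ cong (λ z → c * z ^ n ∸ c) (trans (cong (_/ c) q≡[1+p]c) (m*n/n≡m (suc p) c)) ⟩
  c * suc p ^ n ∸ c            ≡⟨ cong (λ z → c * z ∸ c) (sym (gapBound-closed-form n q≡[1+p]c)) ⟩
  c * (K * p + 1) ∸ c          ≡⟨ cong (_∸ c) (regroup c K p) ⟩
  c + K * (p * c) ∸ c          ≡⟨ m+n∸m≡n c _ ⟩
  K * (p * c)                  ≡⟨ cong (K *_) (sym (trans (cong (_∸ c) q≡[1+p]c) (m+n∸m≡n c (p * c)))) ⟩
  K * (q ∸ c)                  ∎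
  where
  open ≡-Reasoning
  K : ℕ
  K = gapBound q c n
  regroup : ∀ c K p → c * (K * p + 1) ≡ c + K * (p * c)
  regroup = solve-∀

module QuotientIteration (q c x : ℕ) (0<c : 0 < c) (c<q : c < q) where

  instance
    c-nonZero : NonZero c
    c-nonZero = >-nonZero 0<c
    q-nonZero : NonZero q
    q-nonZero = >-nonZero (<-trans 0<c c<q)
    q∸c-nonZero : NonZero (q ∸ c)
    q∸c-nonZero = >-nonZero (m<n⇒0<n∸m c<q)

  e : ℕ
  e = q ∸ c

  c+e≡q : c + e ≡ q
  c+e≡q = m+[n∸m]≡n (<⇒≤ c<q)

  k : ℕ
  k = x / e

  step : ℕ → ℕ
  step s = ((s + 1) * c + x) / q

  step-≤ : ∀ {s} → s ≤ k → step s ≤ k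
  step-≤ s≤k = m<1+n⇒m≤n (m<n*o⇒m/o<n
    (subst (λ z → _ < suc k * z) c+e≡q (numerator-bound s≤k (m<[1+m/n]*n x e))))

  v≤k : ∀ i → v q c x i ≤ k
  v≤k zero    = z≤n
  v≤k (suc i) = step-≤ (v≤k i)

  gap-step : ∀ {s} j → s ≤ k → k ∸ s ≤ gapBound q c (suc j) → k ∸ step s ≤ gapBound q c j
  gap-step {s} j s≤k gap≤ = gap-closes shrinks gap≤
    (subst (λ z → q * K / c * c ≤ z * K) (sym c+e≡q) (m/n*n≤m (q * K) c))
    where
    K : ℕ
    K = gapBound q c j
    s+[k∸s]≡k : s + (k ∸ s) ≡ k
    s+[k∸s]≡k = m+[n∸m]≡n s≤k
    t+[k∸t]≡k : step s + (k ∸ step s) ≡ k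
    t+[k∸t]≡k = m+[n∸m]≡n (step-≤ s≤k)
    ke≤x : (step s + (k ∸ step s)) * e ≤ x
    ke≤x = subst (λ z → z * e ≤ x) (sym t+[k∸t]≡k) (m/n*n≤m x e)
    shrinks : (k ∸ step s) * (c + e) + c < (c + e) + (k ∸ s) * c
    shrinks = gap-shrinks {s = s} {t = step s} (trans s+[k∸s]≡k (sym t+[k∸t]≡k)) ke≤x
      (subst (λ z → _ < suc (step s) * z) (sym c+e≡q) (m<[1+m/n]*n _ q))

  gap-after : ∀ i j → k ≤ gapBound q c (i + j) → k ∸ v q c x i ≤ gapBound q c j
  gap-after zero    j k≤K = k≤K
  gap-after (suc i) j k≤K =
    gap-step j (v≤k i) (gap-after i (suc j) (subst (λ z → k ≤ gapBound q c z) (sym (+-suc i j)) k≤K))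

  v-reaches-quotient : ∀ n → k ≤ gapBound q c n → v q c x n ≡ k
  v-reaches-quotient n k≤K = ≤-antisym (v≤k n)
    (m∸n≡0⇒m≤n (n≤0⇒n≡0 (gap-after n 0 (subst (λ z → k ≤ gapBound q c z) (sym (+-identityʳ n)) k≤K))))

theorem9 : (q c n x : ℕ) → (0<c : 0 < c) → (c<q : c < q) → 1 ≤ n
    → Bound q c n x {{>-nonZero 0<c}}
    → _/_ x (q ∸ c) {{>-nonZero (m<n⇒0<n∸m c<q)}} ≡ v q c x {{>-nonZero (<-≤-trans 0<c (<⇒≤ c<q))}} n
theorem9 q c zero    x 0<c c<q ()
theorem9 q c (suc m) x 0<c c<q _ (divisible-case , nondivisible-case) =
  sym (v-reaches-quotient (suc m) (m≤n*o⇒m/o≤n x≤Ke))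
  where
  open QuotientIteration q c x 0<c c<q
  x≤Ke : x ≤ gapBound q c (suc m) * e
  x≤Ke with c ∣? q
  ... | no c∤q                          = nondivisible-bound m (nondivisible-case c∤q)
  ... | yes (divides zero q≡0)          = contradiction q≡0 (m<n⇒n≢0 c<q)
  ... | yes c∣q@(divides (suc p) q≡[1+p]c)  =
    ≤-trans (divisible-case c∣q) (≤-reflexive (divisible-bound {p = p} (suc m) q≡[1+p]c))
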